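{- Let $a_1,\dots,a_s$ be positive integers, $m=\sum_{i=1}^s(a_i-1)+1$, $p=\max\{a_1,\dots,a_s\}\ge 2$, $m\ge p+2$, and let $r=m-p$. Let $r_0=r_0(p)$ be the smallest integer $r_0\ge2$ with $\min_{t\ge2}\{F_v(2_t,p;t+p-1)-t\} = F_v(2_{r_0},p;r_0+p-1)-r_0$, and suppose $r\ge r_0$. Then $$F_v(a_1,\dots,a_s;m-1)\ge F_v(2_{r_0},p;r_0+p-1)+r-r_0.$$ In particular, if $r_0=2$, then $F_v(a_1,\dots,a_s;m-1)\ge F_v(2,2,p;p+1)+r-2$.
   Context: All graphs are finite, simple, undirected. For a graph $G$, $G \overset{v}{\rightarrow} (a_1,\dots,a_s)$ means: for every coloring of $V(G)$ with $s$ colors there is an $i$ such that $G$ contains an $a_i$-clique all of whose vertices have color $i$. $F_v(a_1,\dots,a_s;q)$ is the minimum number of vertices of a graph $G$ with $G \overset{v}{\rightarrow} (a_1,\dots,a_s)$ and clique number $\omega(G)<q$. $(2_t,p)$ denotes $t$ twos followed by $p$. -}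

module Defs where

open import Data.Nat using (ℕ; zero; suc; _+_; _∸_; _⊔_; _≤_)
open import Data.Fin using (Fin; zero; suc)
open import Data.Bool using (Bool; true)
open import Data.Product using (Σ; ∃; _×_)
open import Relation.Nullary using (¬_)
open import Relation.Binary.PropositionalEquality using (_≡_; _≢_)
open import Function.Definitions using (Injective)

record Graph (n : ℕ) : Set where
  field
    adj    : Fin n → Fin n → Bool
    sym    : ∀ u v → adj u v ≡ adj v u
    irrefl : ∀ v → adj v v ≢ true
open Graph public

record Clique {n : ℕ} (G : Graph n) (k : ℕ) : Set where
  field
    vert   : Fin k → Fin n
    inj    : Injective _≡_ _≡_ vert
    adjacent : ∀ i j → i ≢ j → adj G (vert i) (vert j) ≡ true
open Clique public

CliqueFree : {n : ℕ} → Graph n → ℕ → Set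
CliqueFree G q = ¬ Clique G q

Arrows : {n s : ℕ} → Graph n → (Fin s → ℕ) → Set
Arrows {n} {s} G a =
  ∀ (c : Fin n → Fin s) →
    Σ (Fin s) λ i → Σ (Clique G (a i)) λ K → ∀ j → c (vert K j) ≡ i

-- IsFv a q N : N = F_v(a;q), i.e. some graph on N vertices has the property
-- and every graph with the property has at least N vertices.
IsFv : {s : ℕ} → (Fin s → ℕ) → ℕ → ℕ → Set
IsFv a q N =
  (Σ (Graph N) λ G → Arrows G a × CliqueFree G q) ×
  (∀ n (G : Graph n) → Arrows G a → CliqueFree G q → N ≤ n)

twos : (t p : ℕ) → Fin (suc t) → ℕ
twos zero    p zero    = p
twos (suc t) p zero    = 2
twos (suc t) p (suc i) = twos t p i

sumF : {s : ℕ} → (Fin s → ℕ) → ℕ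
sumF {zero}  f = 0
sumF {suc s} f = f zero + sumF (λ i → f (suc i))

maxF : {s : ℕ} → (Fin s → ℕ) → ℕ
maxF {zero}  f = 0
maxF {suc s} f = f zero ⊔ maxF (λ i → f (suc i))

mOf : {s : ℕ} → (Fin s → ℕ) → ℕ
mOf a = sumF (λ i → a i ∸ 1) + 1

-- Fix j with a j = p and cut r = m - p = Σ_{i ≢ j} (a i - 1) colours into
-- consecutive blocks, one block of a i - 1 colours for each i ≢ j. Colour G with
-- these r colours plus one more, and merge each block into colour i and the extra
-- colour into j. An a i-clique of merged colour i ≢ j uses only a i - 1 of the
-- original colours, so two of its vertices form a monochromatic edge. Hence
-- G →ᵛ (a) implies G →ᵛ (2_r, p); since m - 1 = r + p - 1, G has at least
-- F_v(2_r, p; r + p - 1) vertices, and the choice of r0 bounds this from below by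
-- F_v(2_{r0}, p; r0 + p - 1) + r - r0.
module Submission where

open import Defs
open import Data.Nat using (ℕ; suc; _+_; _∸_; _≤_; _<_)
open import Data.Fin using (Fin)
open import Data.Nat using (zero; z≤n; s≤s)
open import Data.Nat.Properties
  using (+-comm; +-assoc; ≤-trans; n≮0; m∸n+n≡m; m+n∸n≡m; +-∸-assoc; ∸-monoˡ-≤; ∸-monoʳ-<;
         ≤-total; m≥n⇒m⊔n≡m; m≤n⇒m⊔n≡n; module ≤-Reasoning)
open import Data.Fin as Fin using (zero; suc; fromℕ; inject₁; toℕ; splitAt; fromℕ<)
open import Data.Fin.Properties
  using (toℕ<n; suc-injective; toℕ-injective; fromℕ<-injective; <⇒≢; pigeonhole; join-splitAt; _≟_)
open import Data.Fin.Relation.Unary.Top using (view; ‵fromℕ; ‵inject₁)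
open import Data.Vec.Functional using (updateAt)
open import Data.Vec.Functional.Properties using (updateAt-updates; updateAt-minimal)
open import Data.Sum using (_⊎_; inj₁; inj₂)
open import Data.Product using (Σ; ∃; ∃₂; _×_; _,_; proj₁; proj₂; map₁)
open import Data.Product.Properties using (,-injective)
open import Data.Bool using (true)
open import Data.Empty using (⊥-elim)
open import Relation.Nullary using (yes; no)
open import Relation.Binary.PropositionalEquality
  using (_≡_; _≢_; refl; trans; cong; cong₂; subst; subst₂; module ≡-Reasoning)
  renaming (sym to ≡-sym)
open import Function using (_∘_; const)

private
  variable
    n s k : ℕ

sumF-updateAt-zero : (xs : Fin s → ℕ) (j : Fin s) →
  sumF xs ≡ sumF (updateAt xs j (const 0)) + xs j
sumF-updateAt-zero xs zero    = +-comm (xs zero) _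
sumF-updateAt-zero xs (suc j) = begin
  xs zero + sumF (xs ∘ suc)                                        ≡⟨ cong (xs zero +_) (sumF-updateAt-zero (xs ∘ suc) j) ⟩
  xs zero + (sumF (updateAt (xs ∘ suc) j (const 0)) + xs (suc j))  ≡⟨ +-assoc (xs zero) _ _ ⟨
  xs zero + sumF (updateAt (xs ∘ suc) j (const 0)) + xs (suc j)    ∎
  where open ≡-Reasoning

maxF-attained : (a : Fin s → ℕ) → 1 ≤ maxF a → ∃ λ j → a j ≡ maxF a
maxF-attained {zero}  a ()
maxF-attained {suc s} a 1≤max with ≤-total (maxF (a ∘ suc)) (a zero)
... | inj₁ rest≤a₀ = zero , ≡-sym (m≥n⇒m⊔n≡m rest≤a₀)
... | inj₂ a₀≤rest
  with j , aj≡ ← maxF-attained (a ∘ suc) (subst (1 ≤_) (m≤n⇒m⊔n≡n a₀≤rest) 1≤max)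
  = suc j , trans aj≡ (≡-sym (m≤n⇒m⊔n≡n a₀≤rest))

-- Fin (sumF b) is read as consecutive blocks of sizes b 0, b 1, …; locate b k is
-- the block containing k together with the position of k inside it.
locate : (b : Fin s → ℕ) → Fin (sumF b) → Fin s × ℕ
locate⊎ : (b : Fin (suc s) → ℕ) → Fin (b zero) ⊎ Fin (sumF (b ∘ suc)) → Fin (suc s) × ℕ
locate {suc s} b k = locate⊎ b (splitAt (b zero) k)
locate⊎ b (inj₁ u) = zero , toℕ u
locate⊎ b (inj₂ v) = map₁ suc (locate (b ∘ suc) v)

block : (b : Fin s → ℕ) → Fin (sumF b) → Fin s
block b k = proj₁ (locate b k)

offset : (b : Fin s → ℕ) → Fin (sumF b) → ℕ
offset b k = proj₂ (locate b k)

offset<block-size : (b : Fin s → ℕ) (k : Fin (sumF b)) → offset b k < b (block b k)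
offset<block-size {suc s} b k with splitAt (b zero) k
... | inj₁ u = toℕ<n u
... | inj₂ v = offset<block-size (b ∘ suc) v

locate-injective : (b : Fin s → ℕ) {k k′ : Fin (sumF b)} → locate b k ≡ locate b k′ → k ≡ k′
locate⊎-injective : (b : Fin (suc s) → ℕ) {x y : Fin (b zero) ⊎ Fin (sumF (b ∘ suc))} →
  locate⊎ b x ≡ locate⊎ b y → x ≡ y
locate-injective {suc s} b {k} {k′} eq = begin
  k                                      ≡⟨ join-splitAt (b zero) _ k ⟨
  Fin.join _ _ (splitAt (b zero) k)      ≡⟨ cong (Fin.join _ _) (locate⊎-injective b eq) ⟩
  Fin.join _ _ (splitAt (b zero) k′)     ≡⟨ join-splitAt (b zero) _ k′ ⟩
  k′                                     ∎
  where open ≡-Reasoning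
locate⊎-injective b {inj₁ u} {inj₁ u′} eq = cong inj₁ (toℕ-injective (proj₂ (,-injective eq)))
locate⊎-injective b {inj₂ v} {inj₂ v′} eq with i≡i′ , o≡o′ ← ,-injective eq =
  cong inj₂ (locate-injective (b ∘ suc) (cong₂ _,_ (suc-injective i≡i′) o≡o′))
locate⊎-injective b {inj₁ _} {inj₂ _} eq with () ← proj₁ (,-injective eq)
locate⊎-injective b {inj₂ _} {inj₁ _} eq with () ← proj₁ (,-injective eq)

block-pigeonhole : (b : Fin s → ℕ) (i : Fin s) (κ : Fin k → Fin (sumF b)) →
  (∀ x → block b (κ x) ≡ i) → b i < k → ∃₂ λ x y → x ≢ y × κ x ≡ κ y
block-pigeonhole {k = k} b i κ inBlock bi<k = collision (pigeonhole bi<k position)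
  where
  offset< : ∀ x → offset b (κ x) < b i
  offset< x = subst (λ i′ → offset b (κ x) < b i′) (inBlock x) (offset<block-size b (κ x))
  position : Fin k → Fin (b i)
  position x = fromℕ< (offset< x)
  collision : ∃₂ (λ x y → x Fin.< y × position x ≡ position y) → ∃₂ λ x y → x ≢ y × κ x ≡ κ y
  collision (x , y , x<y , samePosition) =
    x , y , <⇒≢ x<y ,
    locate-injective b (cong₂ _,_ (trans (inBlock x) (≡-sym (inBlock y)))
                                  (fromℕ<-injective _ _ (offset< x) (offset< y) samePosition))

twos-fromℕ : (t p : ℕ) → twos t p (fromℕ t) ≡ p
twos-fromℕ zero    p = refl
twos-fromℕ (suc t) p = twos-fromℕ t p

twos-inject₁ : (t p : ℕ) (k : Fin t) → twos t p (inject₁ k) ≡ 2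
twos-inject₁ (suc t) p zero    = refl
twos-inject₁ (suc t) p (suc k) = twos-inject₁ t p k

MonochromaticClique : Graph n → (Fin n → Fin s) → ℕ → Fin s → Set
MonochromaticClique G c k i = Σ (Clique G k) λ K → ∀ x → c (vert K x) ≡ i

monochromatic-edge : (G : Graph n) (c : Fin n → Fin s) {i : Fin s} {u v : Fin n} →
  u ≢ v → adj G u v ≡ true → c u ≡ i → c v ≡ i → MonochromaticClique G c 2 i
monochromatic-edge G c {i} {u} {v} u≢v uv cu cv =
  record { vert = ends ; inj = ends-injective ; adjacent = ends-adjacent } , ends-colour
  where
  ends : Fin 2 → Fin _
  ends zero       = u
  ends (suc zero) = v
  ends-injective : ∀ {x y} → ends x ≡ ends y → x ≡ y
  ends-injective {zero}     {zero}     _  = refl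
  ends-injective {zero}     {suc zero} eq = ⊥-elim (u≢v eq)
  ends-injective {suc zero} {zero}     eq = ⊥-elim (u≢v (≡-sym eq))
  ends-injective {suc zero} {suc zero} _  = refl
  ends-adjacent : ∀ x y → x ≢ y → adj G (ends x) (ends y) ≡ true
  ends-adjacent zero       zero       x≢x = ⊥-elim (x≢x refl)
  ends-adjacent zero       (suc zero) _   = uv
  ends-adjacent (suc zero) zero       _   = trans (Graph.sym G v u) uv
  ends-adjacent (suc zero) (suc zero) x≢x = ⊥-elim (x≢x refl)
  ends-colour : ∀ x → c (ends x) ≡ i
  ends-colour zero       = cu
  ends-colour (suc zero) = cv

module ColourMerging {n s : ℕ} (G : Graph n) (a : Fin s → ℕ) (a≥1 : ∀ i → 1 ≤ a i) (j : Fin s) where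

  sizes : Fin s → ℕ
  sizes = updateAt (λ i → a i ∸ 1) j (const 0)

  R : ℕ
  R = sumF sizes

  merge : Fin (suc R) → Fin s
  merge k with view k
  ... | ‵fromℕ      = j
  ... | ‵inject₁ k′ = block sizes k′

  block≢j : (k : Fin R) → block sizes k ≢ j
  block≢j k eq = n≮0 (subst (offset sizes k <_)
    (trans (cong sizes eq) (updateAt-updates j (λ i → a i ∸ 1)))
    (offset<block-size sizes k))

  merge≡j : (k : Fin (suc R)) → merge k ≡ j → k ≡ fromℕ R
  merge≡j k eq with view k
  ... | ‵fromℕ      = refl
  ... | ‵inject₁ k′ = ⊥-elim (block≢j k′ eq)

  merge≢j : (k : Fin (suc R)) {i : Fin s} → merge k ≡ i → i ≢ j →
    ∃ λ k′ → k ≡ inject₁ k′ × block sizes k′ ≡ i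
  merge≢j k eq i≢j with view k
  ... | ‵fromℕ      = ⊥-elim (i≢j (≡-sym eq))
  ... | ‵inject₁ k′ = k′ , refl , eq

  sizes<a : (i : Fin s) → i ≢ j → sizes i < a i
  sizes<a i i≢j = subst (_< a i) (≡-sym (updateAt-minimal i j (λ i → a i ∸ 1) i≢j))
    (∸-monoʳ-< {o = 0} (s≤s z≤n) (a≥1 i))

  TwosClique : (Fin n → Fin (suc R)) → Set
  TwosClique c = Σ (Fin (suc R)) λ k → MonochromaticClique G c (twos R (a j) k) k

  twos-clique-on-j : (c : Fin n → Fin (suc R)) → MonochromaticClique G (merge ∘ c) (a j) j →
    TwosClique c
  twos-clique-on-j c (K , mono) =
    fromℕ R , subst (λ k → MonochromaticClique G c k (fromℕ R)) (≡-sym (twos-fromℕ R (a j)))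
                    (K , λ x → merge≡j (c (vert K x)) (mono x))

  twos-clique-off-j : (c : Fin n → Fin (suc R)) {i : Fin s} → i ≢ j →
    MonochromaticClique G (merge ∘ c) (a i) i → TwosClique c
  twos-clique-off-j c {i} i≢j (K , mono) =
    edge (block-pigeonhole sizes i κ (proj₂ ∘ proj₂ ∘ low) (sizes<a i i≢j))
    where
    low : ∀ x → ∃ λ k′ → c (vert K x) ≡ inject₁ k′ × block sizes k′ ≡ i
    low x = merge≢j (c (vert K x)) (mono x) i≢j
    κ : Fin (a i) → Fin R
    κ = proj₁ ∘ low
    edge : ∃₂ (λ x y → x ≢ y × κ x ≡ κ y) → TwosClique c
    edge (x , y , x≢y , κx≡κy) =
      inject₁ (κ x) , subst (λ k → MonochromaticClique G c k (inject₁ (κ x)))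
                            (≡-sym (twos-inject₁ R (a j) (κ x)))
                            (monochromatic-edge G c (x≢y ∘ inj K) (adjacent K x y x≢y)
                              (proj₁ (proj₂ (low x)))
                              (trans (proj₁ (proj₂ (low y))) (cong inject₁ (≡-sym κx≡κy))))

  arrows-twos : Arrows G a → Arrows G (twos R (a j))
  arrows-twos arrows c with arrows (merge ∘ c)
  ... | i , mono with i ≟ j
  ... | yes refl = twos-clique-on-j c mono
  ... | no i≢j   = twos-clique-off-j c i≢j mono

  mOf≡R+a : mOf a ≡ R + a j
  mOf≡R+a = begin
    sumF (λ i → a i ∸ 1) + 1   ≡⟨ cong (_+ 1) (sumF-updateAt-zero (λ i → a i ∸ 1) j) ⟩
    R + (a j ∸ 1) + 1          ≡⟨ +-assoc R (a j ∸ 1) 1 ⟩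
    R + (a j ∸ 1 + 1)          ≡⟨ cong (R +_) (m∸n+n≡m (a≥1 j)) ⟩
    R + a j                    ∎
    where open ≡-Reasoning

m+[n∸o]≤p : ∀ m {n o p} → o ≤ n → m + n ≤ p + o → m + (n ∸ o) ≤ p
m+[n∸o]≤p m {n} {o} {p} o≤n m+n≤p+o = begin
  m + (n ∸ o)  ≡⟨ +-∸-assoc m o≤n ⟨
  m + n ∸ o    ≤⟨ ∸-monoˡ-≤ o m+n≤p+o ⟩
  p + o ∸ o    ≡⟨ m+n∸n≡m p o ⟩
  p            ∎
  where open ≤-Reasoning

corollary2 : (s : ℕ) (a : Fin s → ℕ) → (∀ i → 1 ≤ a i) →
    2 ≤ maxF a → maxF a + 2 ≤ mOf a →
    (r0 : ℕ) (f : ℕ → ℕ) →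
    (∀ t → 2 ≤ t → IsFv (twos t (maxF a)) (t + maxF a ∸ 1) (f t)) →
    2 ≤ r0 →
    (∀ t → 2 ≤ t → f r0 + t ≤ f t + r0) →
    (∀ t → 2 ≤ t → t < r0 → f r0 + t < f t + r0) →
    r0 ≤ mOf a ∸ maxF a →
    (n : ℕ) (G : Graph n) → Arrows G a → CliqueFree G (mOf a ∸ 1) →
    f r0 + (mOf a ∸ maxF a ∸ r0) ≤ n
corollary2 s a a≥1 2≤p _ r0 f isFv 2≤r0 r0-minimises _ r0≤r n G arrows cliqueFree = begin
  f r0 + (r ∸ r0)  ≤⟨ m+[n∸o]≤p (f r0) r0≤r (r0-minimises r 2≤r) ⟩
  f r              ≤⟨ proj₂ (isFv r 2≤r) n G arrows-twos-r cliqueFree-r ⟩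
  n                ∎
  where
  open ≤-Reasoning
  p r : ℕ
  p = maxF a
  r = mOf a ∸ p
  2≤r : 2 ≤ r
  2≤r = ≤-trans 2≤r0 r0≤r
  maximum : ∃ λ j → a j ≡ p
  maximum = maxF-attained a (≤-trans (s≤s z≤n) 2≤p)
  j : Fin s
  j = proj₁ maximum
  aj≡p : a j ≡ p
  aj≡p = proj₂ maximum
  open ColourMerging G a a≥1 j using (R; arrows-twos; mOf≡R+a)
  R≡r : R ≡ r
  R≡r = trans (≡-sym (m+n∸n≡m R (a j))) (cong₂ _∸_ (≡-sym mOf≡R+a) aj≡p)
  arrows-twos-r : Arrows G (twos r p)
  arrows-twos-r = subst₂ (λ t q → Arrows G (twos t q)) R≡r aj≡p (arrows-twos arrows)
  cliqueFree-r : CliqueFree G (r + p ∸ 1)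
  cliqueFree-r = subst (λ k → CliqueFree G (k ∸ 1))
    (trans mOf≡R+a (cong₂ _+_ R≡r aj≡p)) cliqueFree
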